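{- Let $G=(V,E)$ be a finite, undirected, unweighted, simple, connected graph with $N=|V|$ nodes and $M=|E|$ edges, and let $d_1\ge d_2\ge\dots\ge d_N$ be its degree sequence listed in non-increasing order. Let $n_1\in\{0,1,\dots,N\}$ and $n_0=N-n_1$, and let each node $i$ carry a binary characteristic $c_i\in\{0,1\}$ such that exactly $n_1$ nodes have $c_i=1$ (and $n_0$ nodes have $c_i=0$). Let $m_{10}$ denote the number of edges with one endpoint of characteristic $1$ and the other of characteristic $0$. Then $$m_{10}\le UBm_{10}:=\min\Bigg( M,\ n_1 n_0,\ \min\bigg( \sum_{i=1}^{n_1}\min(d_i,\,n_0),\ \sum_{i=1}^{n_0}\min(d_i,\,n_1)\bigg)\Bigg).$$
   Context: The degree $d_i$ of a node is the number of edges incident to it. The sums $\sum_{i=1}^{n_1}$ and $\sum_{i=1}^{n_0}$ run over the $n_1$ (respectively $n_0$) largest degrees, i.e. the heads of the non-increasingly ordered degree sequence; an empty sum is $0$. -}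

module Defs where

open import Data.Nat using (ℕ; zero; suc; _+_; _*_; _∸_; _≤_; _≥_; _<_; _⊓_)
open import Data.Nat.Properties using (_<?_)
open import Data.Bool using (Bool; true; false; if_then_else_; _∧_; _xor_)
open import Data.Fin using (Fin; toℕ)
open import Data.List using (List; map; allFin)
open import Data.Nat.ListAction using (sum)
open import Data.Product using (_×_; Σ)
open import Relation.Nullary.Decidable using (⌊_⌋)
open import Relation.Binary.PropositionalEquality using (_≡_)
open import Function.Definitions using (Injective)

ΣFin : (n : ℕ) → (Fin n → ℕ) → ℕ
ΣFin n f = sum (map f (allFin n))

𝟙 : Bool → ℕ
𝟙 true  = 1
𝟙 false = 0

record SimpleGraph (N : ℕ) : Set where
  field
    adj       : Fin N → Fin N → Bool
    symmetric : ∀ i j → adj i j ≡ adj j i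
    loopless  : ∀ i → adj i i ≡ false
open SimpleGraph public

data Reachable {N : ℕ} (G : SimpleGraph N) : Fin N → Fin N → Set where
  here : ∀ {i} → Reachable G i i
  step : ∀ {i j k} → adj G i j ≡ true → Reachable G j k → Reachable G i k

Connected : {N : ℕ} → SimpleGraph N → Set
Connected {N} G = ∀ (i j : Fin N) → Reachable G i j

degree : {N : ℕ} → SimpleGraph N → Fin N → ℕ
degree {N} G i = ΣFin N (λ j → 𝟙 (adj G i j))

-- number of (unordered) edges satisfying a predicate on the endpoint pair:
-- each edge {i,j} is counted once, as the ordered pair with i < j
edgeCount : {N : ℕ} → SimpleGraph N → (Fin N → Fin N → Bool) → ℕ
edgeCount {N} G P =
  ΣFin N (λ i → ΣFin N (λ j → 𝟙 (⌊ toℕ i <? toℕ j ⌋ ∧ adj G i j ∧ P i j)))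

numEdges : {N : ℕ} → SimpleGraph N → ℕ
numEdges G = edgeCount G (λ _ _ → true)

m10 : {N : ℕ} → SimpleGraph N → (Fin N → Bool) → ℕ
m10 G c = edgeCount G (λ i j → c i xor c j)

countOnes : {N : ℕ} → (Fin N → Bool) → ℕ
countOnes {N} c = ΣFin N (λ i → 𝟙 (c i))

-- σ lists the vertices so that d(σ 0) ≥ d(σ 1) ≥ … ≥ d(σ (N-1)):
-- σ is a bijection of Fin N (injective endomap of a finite set) and the
-- degrees along it are non-increasing.
DegreeOrdering : {N : ℕ} → SimpleGraph N → (Fin N → Fin N) → Set
DegreeOrdering {N} G σ =
  Injective _≡_ _≡_ σ × (∀ (k l : Fin N) → toℕ k ≤ toℕ l → degree G (σ k) ≥ degree G (σ l))

-- Σ_{i=1}^{n} f(d_i) over the n largest degrees (d_i = degree G (σ (i-1)));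
-- empty when n = 0.
headSum : {N : ℕ} → SimpleGraph N → (Fin N → Fin N) → ℕ → (ℕ → ℕ) → ℕ
headSum {N} G σ n f = ΣFin N (λ k → if ⌊ toℕ k <? n ⌋ then f (degree G (σ k)) else 0)

UBm10 : {N : ℕ} → SimpleGraph N → (Fin N → Fin N) → ℕ → ℕ
UBm10 {N} G σ n₁ =
  let n₀ = N ∸ n₁ in
  numEdges G ⊓ (n₁ * n₀ ⊓
    (headSum G σ n₁ (λ d → d ⊓ n₀) ⊓ headSum G σ n₀ (λ d → d ⊓ n₁)))

-- A crossing edge has exactly one endpoint of characteristic 1, so m₁₀ is at most
-- the sum, over the n₁ vertices with c i = 1, of their numbers of neighbours with
-- characteristic 0. Such a count is at most min(d_i, n₀), which gives n₁ n₀ at once,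
-- and a sum of n₁ values taken from the non-increasing sequence min(d_k, n₀) is at
-- most the sum of its first n₁ terms. Exchanging the two characteristics gives the
-- remaining bound, and m₁₀ ≤ M is immediate.
module Submission where

open import Defs
open import Data.Bool using (Bool; true; false; not; _∧_; _xor_; if_then_else_)
open import Data.Bool.Properties using (not-involutive; not-distribˡ-xor; not-distribʳ-xor)
open import Data.Fin as Fin using (Fin; toℕ; punchIn; punchOut)
open import Data.Fin.Properties using (punchIn-punchOut; punchOut-injective)
open import Data.List using (tabulate)
open import Data.List.Properties using (map-tabulate)
open import Data.Nat using (ℕ; zero; suc; _+_; _*_; _∸_; _≤_; _≥_; _⊓_; z≤n; s≤s)
open import Data.Nat.ListAction as ListAction using ()
open import Data.Nat.Properties
open import Algebra.Properties.CommutativeMonoid.Sum +-0-commutativeMonoid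
  using (sum; sum-syntax; sum-cong-≗; sum-remove; sum-replicate-zero; ∑-comm; ∑-distrib-+)
open import Data.Product using (_,_)
open import Data.Vec.Functional using (Vector; tail)
open import Function using (_∘_; id)
open import Function.Definitions using (Injective)
open import Relation.Binary.Core using (_Preserves_⟶_)
open import Relation.Binary.PropositionalEquality
open import Relation.Nullary using (yes; no; contradiction)
open import Relation.Nullary.Decidable using (⌊_⌋)

listSum-tabulate : ∀ {n} (f : Vector ℕ n) → ListAction.sum (tabulate f) ≡ sum f
listSum-tabulate {zero}  f = refl
listSum-tabulate {suc n} f = cong (f Fin.zero +_) (listSum-tabulate (f ∘ Fin.suc))

ΣFin≡sum : ∀ n (f : Vector ℕ n) → ΣFin n f ≡ sum f
ΣFin≡sum n f = trans (cong ListAction.sum (map-tabulate id f)) (listSum-tabulate f)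

ΣFin-cong : ∀ n {f g : Vector ℕ n} → (∀ i → f i ≡ g i) → ΣFin n f ≡ ΣFin n g
ΣFin-cong n {f} {g} f≗g = trans (ΣFin≡sum n f) (trans (sum-cong-≗ f≗g) (sym (ΣFin≡sum n g)))

sum-mono-≤ : ∀ {n} {f g : Vector ℕ n} → (∀ i → f i ≤ g i) → sum f ≤ sum g
sum-mono-≤ {zero}  f≤g = z≤n
sum-mono-≤ {suc n} f≤g = +-mono-≤ (f≤g Fin.zero) (sum-mono-≤ (f≤g ∘ Fin.suc))

sum-∘-injective : ∀ {n} (σ : Fin n → Fin n) → Injective _≡_ _≡_ σ →
                  (f : Vector ℕ n) → sum (f ∘ σ) ≡ sum f
sum-∘-injective {zero}  σ σ-inj f = refl
sum-∘-injective {suc n} σ σ-inj f = begin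
  f σ₀ + sum (f ∘ σ ∘ Fin.suc)
    ≡⟨ cong (f σ₀ +_) (sum-cong-≗ (cong f ∘ sym ∘ punchIn-punchOut ∘ σ₀≢σₛ)) ⟩
  f σ₀ + sum (f ∘ punchIn σ₀ ∘ τ)
    ≡⟨ cong (f σ₀ +_) (sum-∘-injective τ τ-inj (f ∘ punchIn σ₀)) ⟩
  f σ₀ + sum (f ∘ punchIn σ₀)
    ≡⟨ sum-remove {i = σ₀} f ⟨
  sum f
    ∎
  where
  open ≡-Reasoning
  σ₀ = σ Fin.zero
  σ₀≢σₛ : ∀ k → σ₀ ≢ σ (Fin.suc k)
  σ₀≢σₛ k eq with () ← σ-inj eq
  τ : Fin n → Fin n
  τ k = punchOut (σ₀≢σₛ k)
  τ-inj : Injective _≡_ _≡_ τ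
  τ-inj {k} {l} eq with refl ← σ-inj (punchOut-injective (σ₀≢σₛ k) (σ₀≢σₛ l) eq) = refl

if-mono-≤ : ∀ b {x y} → x ≤ y → (if b then x else 0) ≤ (if b then y else 0)
if-mono-≤ true  x≤y = x≤y
if-mono-≤ false x≤y = z≤n

sum-if : ∀ {n} b (f : Vector ℕ n) → sum (λ j → if b then f j else 0) ≡ (if b then sum f else 0)
sum-if true  f = refl
sum-if {n} false f = sum-replicate-zero n

sum-select-const : ∀ {n} (b : Vector Bool n) k → sum (λ i → if b i then k else 0) ≡ sum (𝟙 ∘ b) * k
sum-select-const {zero}  b k = refl
sum-select-const {suc n} b k with b Fin.zero
... | true  = cong (k +_) (sum-select-const (tail b) k)
... | false = sum-select-const (tail b) k

sum-𝟙+sum-𝟙-not : ∀ {n} (b : Vector Bool n) → sum (𝟙 ∘ b) + sum (𝟙 ∘ not ∘ b) ≡ n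
sum-𝟙+sum-𝟙-not {zero}  b = refl
sum-𝟙+sum-𝟙-not {suc n} b with b Fin.zero
... | true  = cong suc (sum-𝟙+sum-𝟙-not (tail b))
... | false = trans (+-suc _ _) (cong suc (sum-𝟙+sum-𝟙-not (tail b)))

sumFirst : ∀ {n} → Vector ℕ n → ℕ → ℕ
sumFirst a m = sum (λ k → if ⌊ toℕ k <? m ⌋ then a k else 0)

NonIncreasing : ∀ {n} → Vector ℕ n → Set
NonIncreasing a = a Preserves Fin._≤_ ⟶ _≥_

suc<?suc : ∀ x m → ⌊ suc x <? suc m ⌋ ≡ ⌊ x <? m ⌋
suc<?suc x m with x <? m | suc x <? suc m
... | yes _   | yes _    = refl
... | no _    | no _     = refl
... | yes x<m | no sx≮sm  = contradiction (s≤s x<m) sx≮sm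
... | no x≮m  | yes sx<sm = contradiction (≤-pred sx<sm) x≮m

sumFirst-zero : ∀ {n} (a : Vector ℕ n) → sumFirst a 0 ≡ 0
sumFirst-zero {n} a = sum-replicate-zero n

sumFirst-suc : ∀ {n} (a : Vector ℕ (suc n)) m → sumFirst a (suc m) ≡ a Fin.zero + sumFirst (tail a) m
sumFirst-suc a m = cong (a Fin.zero +_)
  (sum-cong-≗ (λ k → cong (if_then a (Fin.suc k) else 0) (suc<?suc (toℕ k) m)))

sumFirst-tail-≤ : ∀ {n} (a : Vector ℕ (suc n)) → NonIncreasing a →
                  ∀ m → sumFirst (tail a) m ≤ sumFirst a m
sumFirst-tail-≤ a a↓ zero = ≤-reflexive (trans (sumFirst-zero (tail a)) (sym (sumFirst-zero a)))
sumFirst-tail-≤ {zero}  a a↓ (suc m) = z≤n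
sumFirst-tail-≤ {suc n} a a↓ (suc m) = begin
  sumFirst (tail a) (suc m)
    ≡⟨ sumFirst-suc (tail a) m ⟩
  a 1F + sumFirst (tail (tail a)) m
    ≤⟨ +-mono-≤ (a↓ z≤n) (sumFirst-tail-≤ (tail a) (a↓ ∘ s≤s) m) ⟩
  a 0F + sumFirst (tail a) m
    ≡⟨ sumFirst-suc a m ⟨
  sumFirst a (suc m)
    ∎
  where
  open ≤-Reasoning
  0F = Fin.zero
  1F = Fin.suc Fin.zero

sum-select-≤-sumFirst : ∀ {n} (a : Vector ℕ n) → NonIncreasing a → (b : Vector Bool n) →
                        sum (λ k → if b k then a k else 0) ≤ sumFirst a (sum (𝟙 ∘ b))
sum-select-≤-sumFirst {zero}  a a↓ b = z≤n
sum-select-≤-sumFirst {suc n} a a↓ b with b Fin.zero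
... | true  = ≤-trans (+-monoʳ-≤ (a Fin.zero) (sum-select-≤-sumFirst (tail a) (a↓ ∘ s≤s) (tail b)))
                      (≤-reflexive (sym (sumFirst-suc a _)))
... | false = ≤-trans (sum-select-≤-sumFirst (tail a) (a↓ ∘ s≤s) (tail b))
                      (sumFirst-tail-≤ a a↓ _)

if-<-+-if->-≤ : ∀ m n x → (if ⌊ m <? n ⌋ then x else 0) + (if ⌊ n <? m ⌋ then x else 0) ≤ x
if-<-+-if->-≤ m n x with m <? n | n <? m
... | yes m<n | yes n<m = contradiction n<m (<-asym m<n)
... | yes _   | no _    = ≤-reflexive (+-identityʳ x)
... | no _    | yes _   = ≤-refl
... | no _    | no _    = z≤n

∑∑-distrib-+ : ∀ {n} (f g : Fin n → Fin n → ℕ) →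
               ∑[ i < n ] ∑[ j < n ] (f i j + g i j)
                 ≡ ∑[ i < n ] ∑[ j < n ] f i j + ∑[ i < n ] ∑[ j < n ] g i j
∑∑-distrib-+ {n} f g = trans (sum-cong-≗ (λ i → ∑-distrib-+ (f i) (g i)))
                             (∑-distrib-+ (λ i → ∑[ j < n ] f i j) (λ i → ∑[ j < n ] g i j))

∑∑-upper-symmetrize-≤ : ∀ {n} (f : Fin n → Fin n → ℕ) →
  ∑[ i < n ] ∑[ j < n ] (if ⌊ toℕ i <? toℕ j ⌋ then f i j + f j i else 0)
    ≤ ∑[ i < n ] ∑[ j < n ] f i j
∑∑-upper-symmetrize-≤ {n} f = begin
  ∑[ i < n ] ∑[ j < n ] (if i ≺ j then f i j + f j i else 0)
    ≡⟨ sum-cong-≗ (λ i → sum-cong-≗ (λ j → if-distrib-+ (i ≺ j) (f i j) (f j i))) ⟩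
  ∑[ i < n ] ∑[ j < n ] (upper f i j + upper fᵀ i j)
    ≡⟨ ∑∑-distrib-+ (upper f) (upper fᵀ) ⟩
  ∑[ i < n ] ∑[ j < n ] upper f i j + ∑[ i < n ] ∑[ j < n ] upper fᵀ i j
    ≡⟨ cong (∑[ i < n ] ∑[ j < n ] upper f i j +_) (∑-comm (upper fᵀ)) ⟩
  ∑[ i < n ] ∑[ j < n ] upper f i j + ∑[ i < n ] ∑[ j < n ] lower f i j
    ≡⟨ ∑∑-distrib-+ (upper f) (lower f) ⟨
  ∑[ i < n ] ∑[ j < n ] (upper f i j + lower f i j)
    ≤⟨ sum-mono-≤ (λ i → sum-mono-≤ (λ j → if-<-+-if->-≤ (toℕ i) (toℕ j) (f i j))) ⟩
  ∑[ i < n ] ∑[ j < n ] f i j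
    ∎
  where
  open ≤-Reasoning
  _≺_ : Fin n → Fin n → Bool
  i ≺ j = ⌊ toℕ i <? toℕ j ⌋
  fᵀ : Fin n → Fin n → ℕ
  fᵀ i j = f j i
  upper lower : (Fin n → Fin n → ℕ) → Fin n → Fin n → ℕ
  upper g i j = if i ≺ j then g i j else 0
  lower g i j = if j ≺ i then g i j else 0
  if-distrib-+ : ∀ b x y → (if b then x + y else 0) ≡ (if b then x else 0) + (if b then y else 0)
  if-distrib-+ true  x y = refl
  if-distrib-+ false x y = refl

𝟙-∧-≤ˡ : ∀ a b → 𝟙 (a ∧ b) ≤ 𝟙 a
𝟙-∧-≤ˡ false b     = z≤n
𝟙-∧-≤ˡ true  false = z≤n
𝟙-∧-≤ˡ true  true  = ≤-refl

𝟙-∧-≤ʳ : ∀ a b → 𝟙 (a ∧ b) ≤ 𝟙 b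
𝟙-∧-≤ʳ false b = z≤n
𝟙-∧-≤ʳ true  b = ≤-refl

𝟙-∧-xor : ∀ a u v →
          𝟙 (a ∧ (u xor v)) ≡ (if u then 𝟙 (a ∧ not v) else 0) + (if v then 𝟙 (a ∧ not u) else 0)
𝟙-∧-xor false false false = refl
𝟙-∧-xor false false true  = refl
𝟙-∧-xor false true  false = refl
𝟙-∧-xor false true  true  = refl
𝟙-∧-xor true  false false = refl
𝟙-∧-xor true  false true  = refl
𝟙-∧-xor true  true  false = refl
𝟙-∧-xor true  true  true  = refl

not-xor-not : ∀ u v → (not u xor not v) ≡ (u xor v)
not-xor-not u v = begin
  not u xor not v     ≡⟨ not-distribˡ-xor u (not v) ⟨
  not (u xor not v)   ≡⟨ cong not (not-distribʳ-xor u v) ⟨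
  not (not (u xor v)) ≡⟨ not-involutive (u xor v) ⟩
  u xor v             ∎
  where open ≡-Reasoning

module _ {N : ℕ} (G : SimpleGraph N) where

  degreeInto : (Fin N → Bool) → Fin N → ℕ
  degreeInto S i = sum (λ j → 𝟙 (adj G i j ∧ S j))

  degreeInto≤degree : ∀ S i → degreeInto S i ≤ degree G i
  degreeInto≤degree S i =
    ≤-trans (sum-mono-≤ (λ j → 𝟙-∧-≤ˡ (adj G i j) (S j))) (≤-reflexive (sym (ΣFin≡sum N _)))

  degreeInto≤countOnes : ∀ S i → degreeInto S i ≤ countOnes S
  degreeInto≤countOnes S i =
    ≤-trans (sum-mono-≤ (λ j → 𝟙-∧-≤ʳ (adj G i j) (S j))) (≤-reflexive (sym (ΣFin≡sum N _)))

  edgeIndicator : (Fin N → Fin N → Bool) → Fin N → Fin N → ℕ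
  edgeIndicator P i j = 𝟙 (⌊ toℕ i <? toℕ j ⌋ ∧ adj G i j ∧ P i j)

  edgeCount≡∑∑ : ∀ P → edgeCount G P ≡ ∑[ i < N ] ∑[ j < N ] edgeIndicator P i j
  edgeCount≡∑∑ P = trans (ΣFin≡sum N _) (sum-cong-≗ (λ i → ΣFin≡sum N (edgeIndicator P i)))

  edgeCount-cong : ∀ {P Q} → (∀ i j → P i j ≡ Q i j) → edgeCount G P ≡ edgeCount G Q
  edgeCount-cong P≡Q = ΣFin-cong N (λ i → ΣFin-cong N (λ j →
    cong (λ b → 𝟙 (⌊ toℕ i <? toℕ j ⌋ ∧ adj G i j ∧ b)) (P≡Q i j)))

  edgeCount≤numEdges : ∀ P → edgeCount G P ≤ numEdges G
  edgeCount≤numEdges P = begin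
    edgeCount G P
      ≡⟨ edgeCount≡∑∑ P ⟩
    ∑[ i < N ] ∑[ j < N ] edgeIndicator P i j
      ≤⟨ sum-mono-≤ (λ i → sum-mono-≤ (λ j → ∧∧-≤ (⌊ toℕ i <? toℕ j ⌋) (adj G i j) (P i j))) ⟩
    ∑[ i < N ] ∑[ j < N ] edgeIndicator (λ _ _ → true) i j
      ≡⟨ edgeCount≡∑∑ _ ⟨
    numEdges G
      ∎
    where
    open ≤-Reasoning
    ∧∧-≤ : ∀ x a p → 𝟙 (x ∧ a ∧ p) ≤ 𝟙 (x ∧ a ∧ true)
    ∧∧-≤ false a     p = z≤n
    ∧∧-≤ true  false p = z≤n
    ∧∧-≤ true  true  p = 𝟙-∧-≤ˡ true p

  m10-not : ∀ c → m10 G (not ∘ c) ≡ m10 G c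
  m10-not c = edgeCount-cong (λ i j → not-xor-not (c i) (c j))

  m10≤∑degreeInto : ∀ c → m10 G c ≤ ∑[ i < N ] (if c i then degreeInto (not ∘ c) i else 0)
  m10≤∑degreeInto c = begin
    m10 G c
      ≡⟨ edgeCount≡∑∑ _ ⟩
    ∑[ i < N ] ∑[ j < N ] edgeIndicator (λ i j → c i xor c j) i j
      ≡⟨ sum-cong-≗ (λ i → sum-cong-≗ (λ j → split-cross (⌊ toℕ i <? toℕ j ⌋) i j)) ⟩
    ∑[ i < N ] ∑[ j < N ] (if ⌊ toℕ i <? toℕ j ⌋ then D i j + D j i else 0)
      ≤⟨ ∑∑-upper-symmetrize-≤ D ⟩
    ∑[ i < N ] ∑[ j < N ] D i j
      ≡⟨ sum-cong-≗ (λ i → sum-if (c i) (λ j → 𝟙 (adj G i j ∧ not (c j)))) ⟩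
    ∑[ i < N ] (if c i then degreeInto (not ∘ c) i else 0)
      ∎
    where
    open ≤-Reasoning
    D : Fin N → Fin N → ℕ
    D i j = if c i then 𝟙 (adj G i j ∧ not (c j)) else 0
    split-cross : ∀ x i j → 𝟙 (x ∧ adj G i j ∧ (c i xor c j)) ≡ (if x then D i j + D j i else 0)
    split-cross false i j = refl
    split-cross true  i j rewrite symmetric G j i = 𝟙-∧-xor (adj G i j) (c i) (c j)

  module _ (c : Fin N → Bool) where

    private
      n₀ : ℕ
      n₀ = countOnes (not ∘ c)

    m10≤countOnes*countOnes-not : m10 G c ≤ countOnes c * n₀
    m10≤countOnes*countOnes-not = begin
      m10 G c
        ≤⟨ m10≤∑degreeInto c ⟩
      ∑[ i < N ] (if c i then degreeInto (not ∘ c) i else 0)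
        ≤⟨ sum-mono-≤ (λ i → if-mono-≤ (c i) (degreeInto≤countOnes (not ∘ c) i)) ⟩
      ∑[ i < N ] (if c i then n₀ else 0)
        ≡⟨ sum-select-const c n₀ ⟩
      sum (𝟙 ∘ c) * n₀
        ≡⟨ cong (_* n₀) (ΣFin≡sum N (𝟙 ∘ c)) ⟨
      countOnes c * n₀
        ∎
      where open ≤-Reasoning

    m10≤headSum : ∀ σ → DegreeOrdering G σ → m10 G c ≤ headSum G σ (countOnes c) (λ d → d ⊓ n₀)
    m10≤headSum σ (σ-inj , σ-sorted) = begin
      m10 G c
        ≤⟨ m10≤∑degreeInto c ⟩
      ∑[ i < N ] (if c i then degreeInto (not ∘ c) i else 0)
        ≤⟨ sum-mono-≤ (λ i → if-mono-≤ (c i) (degreeInto≤g i)) ⟩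
      ∑[ i < N ] (if c i then g i else 0)
        ≡⟨ sum-∘-injective σ σ-inj (λ i → if c i then g i else 0) ⟨
      ∑[ k < N ] (if c (σ k) then g (σ k) else 0)
        ≤⟨ sum-select-≤-sumFirst (g ∘ σ) g∘σ-nonIncreasing (c ∘ σ) ⟩
      sumFirst (g ∘ σ) (sum (𝟙 ∘ c ∘ σ))
        ≡⟨ cong (sumFirst (g ∘ σ)) count-c∘σ≡ ⟩
      sumFirst (g ∘ σ) (countOnes c)
        ≡⟨ ΣFin≡sum N _ ⟨
      headSum G σ (countOnes c) (λ d → d ⊓ n₀)
        ∎
      where
      open ≤-Reasoning
      g : Fin N → ℕ
      g i = degree G i ⊓ n₀
      degreeInto≤g : ∀ i → degreeInto (not ∘ c) i ≤ g i
      degreeInto≤g i = ⊓-glb (degreeInto≤degree (not ∘ c) i) (degreeInto≤countOnes (not ∘ c) i)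
      g∘σ-nonIncreasing : NonIncreasing (g ∘ σ)
      g∘σ-nonIncreasing {k} {l} k≤l = ⊓-monoˡ-≤ n₀ (σ-sorted k l k≤l)
      count-c∘σ≡ : sum (𝟙 ∘ c ∘ σ) ≡ countOnes c
      count-c∘σ≡ = trans (sum-∘-injective σ σ-inj (𝟙 ∘ c)) (sym (ΣFin≡sum N (𝟙 ∘ c)))

countOnes-not : ∀ {N} (c : Fin N → Bool) → countOnes (not ∘ c) ≡ N ∸ countOnes c
countOnes-not {N} c = begin
  countOnes (not ∘ c)                             ≡⟨ m+n∸m≡n (countOnes c) _ ⟨
  countOnes c + countOnes (not ∘ c) ∸ countOnes c ≡⟨ cong (_∸ countOnes c) count-sum ⟩
  N ∸ countOnes c                                 ∎
  where
  open ≡-Reasoning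
  count-sum : countOnes c + countOnes (not ∘ c) ≡ N
  count-sum = trans (cong₂ _+_ (ΣFin≡sum N (𝟙 ∘ c)) (ΣFin≡sum N (𝟙 ∘ not ∘ c)))
                    (sum-𝟙+sum-𝟙-not c)

proposition3p2 : (N : ℕ) (G : SimpleGraph N) → Connected G →
                 (σ : Fin N → Fin N) → DegreeOrdering G σ →
                 (n₁ : ℕ) → n₁ ≤ N →
                 (c : Fin N → Bool) → countOnes c ≡ n₁ →
                 m10 G c ≤ UBm10 G σ n₁
proposition3p2 N G _ σ σ-ord _ _ c refl =
  ⊓-glb (edgeCount≤numEdges G _) (⊓-glb product-bound (⊓-glb ones-bound zeros-bound))
  where
  n₀≡ : countOnes (not ∘ c) ≡ N ∸ countOnes c
  n₀≡ = countOnes-not c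
  not-not-c≡ : countOnes (not ∘ not ∘ c) ≡ countOnes c
  not-not-c≡ = ΣFin-cong N (λ i → cong 𝟙 (not-involutive (c i)))
  product-bound : m10 G c ≤ countOnes c * (N ∸ countOnes c)
  product-bound = subst (λ n₀ → m10 G c ≤ countOnes c * n₀) n₀≡
                        (m10≤countOnes*countOnes-not G c)
  ones-bound : m10 G c ≤ headSum G σ (countOnes c) (λ d → d ⊓ (N ∸ countOnes c))
  ones-bound = subst (λ n₀ → m10 G c ≤ headSum G σ (countOnes c) (λ d → d ⊓ n₀)) n₀≡
                     (m10≤headSum G c σ σ-ord)
  zeros-bound : m10 G c ≤ headSum G σ (N ∸ countOnes c) (λ d → d ⊓ countOnes c)
  zeros-bound =
    subst₂ (λ m n₀ → m ≤ headSum G σ n₀ (λ d → d ⊓ countOnes c)) (m10-not G c) n₀≡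
      (subst (λ n₁ → m10 G (not ∘ c) ≤ headSum G σ (countOnes (not ∘ c)) (λ d → d ⊓ n₁)) not-not-c≡
        (m10≤headSum G (not ∘ c) σ σ-ord))
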